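{- Let $r<n$ be positive integers. There is a deterministic streaming algorithm that solves $\mathrm{MIF}(n,r)$ using $O\left(\sqrt{r \log r} + \frac{r \log r}{\log n}\right)$ bits of space.
   Context: For integers $r<n$, $\mathrm{MIF}(n,r)$ (Missing Item Finding): given a stream $a_1,\ldots,a_r\in[n]$ (repetitions allowed), output some $x\in[n]$ with $x\ne a_i$ for all $i$. A deterministic streaming algorithm has a finite state set $\Sigma$, a fixed initial state, and deterministic transition and output functions; it must output a correct answer on every stream; its space is $\lceil\log_2|\Sigma|\rceil$ bits. Logarithms base 2. -}

module Defs where

open import Data.Nat using (ℕ; zero; suc; _+_; _*_; _≤?_)
open import Data.Nat.Logarithm using (⌈log₂_⌉)
open import Data.Fin using (Fin)
open import Data.Vec using (Vec; foldl; lookup)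
open import Relation.Nullary using (¬_; yes; no)
open import Relation.Binary.PropositionalEquality using (_≡_)

-- A deterministic streaming algorithm over the alphabet [n] = Fin n.
-- The finite state set Σ is represented as Fin states (any finite set is
-- in bijection with some Fin k).
record StreamAlg (n : ℕ) : Set where
  field
    states : ℕ
    init   : Fin states
    step   : Fin states → Fin n → Fin states
    output : Fin states → Fin n

open StreamAlg public

space : ∀ {n} → StreamAlg n → ℕ
space A = ⌈log₂ states A ⌉

run : ∀ {n r} (A : StreamAlg n) → Vec (Fin n) r → Fin (states A)
run A v = foldl _ (step A) (init A) v

SolvesMIF : ∀ {n} (r : ℕ) → StreamAlg n → Set
SolvesMIF {n} r A =
  (v : Vec (Fin n) r) (i : Fin r) → ¬ (output A (run A v) ≡ lookup v i)

⌊√_⌋ : ℕ → ℕ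
⌊√ zero ⌋ = zero
⌊√ suc x ⌋ with suc ⌊√ x ⌋ * suc ⌊√ x ⌋ ≤? suc x
... | yes _ = suc ⌊√ x ⌋
... | no  _ = ⌊√ x ⌋

-- View the numbers below (ℓ + 1) ^ t ≤ n as t-digit numbers in base ℓ + 1
-- and read the stream in t rounds of ℓ elements. Each round fixes one more
-- digit of the answer, most significant first: the ℓ elements of a round hit
-- at most ℓ of the ℓ + 1 sub-blocks of the current block, and the algorithm
-- descends into a missed one, which also avoids every earlier element since
-- those lie outside the current block. The state (level, counter, prefix and
-- an (ℓ + 1)-bit bitmap) takes about t log ℓ + ℓ bits; with ℓ ≈ r / t and
-- t ≈ min(√(r log r), (log n) / 3) / log r, or t = 1 when log n < 3 log r,
-- this is O(√(r log r) + r log r / log n).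
{-# OPTIONS --safe #-}
module Submission where

open import Defs
open import Data.Bool using (true; false)
open import Data.Empty using (⊥-elim)
open import Data.Fin using (Fin; zero; suc; toℕ; fromℕ; fromℕ<)
open import Data.Fin.Properties using (toℕ<n; toℕ-fromℕ; toℕ-fromℕ<; toℕ-injective; 2↔Bool; *↔×)
open import Data.Fin.Subset using (Subset; ⁅_⁆; _∪_; ∣_∣; _∈_; _∉_; _⊆_; ⊤; ∁) renaming (⊥ to ∅)
open import Data.Fin.Subset.Properties
  using (∣p∣≤∣x∷p∣; ∣⊥∣≡0; ∣⊤∣≡n; ∣⁅x⁆∣≡1; x∈⁅x⁆; x∈p∪q⁺; x∈∁p⇒x∉p; x∉∁p⇒x∈p; p⊆q⇒∣p∣≤∣q∣; nonempty?)
open import Data.Nat using (ℕ; _+_; _*_; _≤_; _<_; zero; suc; pred; _^_; z≤n; s≤s; s≤s⁻¹; NonZero; >-nonZero; >-nonZero⁻¹; ⌊_/2⌋; ⌈_/2⌉)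
open import Data.Nat.Divisibility using (divides-refl)
open import Data.Nat.DivMod
open import Data.Nat.Induction using (<-wellFounded)
open import Data.Nat.Logarithm using (⌈log₂_⌉; ⌊log₂_⌋; ⌈log₂⌉-mono-≤; ⌈log₂2^n⌉≡n)
open import Data.Nat.Logarithm.Core using (⌊log2⌋; ⌈log2⌉)
open import Data.Nat.Properties
open import Data.Nat.Tactic.RingSolver using (solve-∀)
open import Data.Product using (Σ; _×_; _,_; proj₁; proj₂)
open import Data.Product.Function.NonDependent.Propositional using (_×-↔_)
open import Data.Sum using (_⊎_; inj₁; inj₂)
open import Data.Vec using (Vec; []; _∷_; foldl; lookup)
open import Data.Vec.Recursive using (lift↔; Fin[m^n]↔Fin[m]^n)
open import Data.Vec.Recursive.Properties using (↔Vec)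
open import Function.Base using (_∘_)
open import Function.Bundles using (_↔_; Inverse; mk↔ₛ′)
open import Function.Properties.Inverse using (↔-refl; ↔-sym; ↔-trans)
open import Induction.WellFounded using (Acc; acc)
open import Relation.Binary.PropositionalEquality
open import Relation.Nullary using (yes; no; contradiction)

module Encoded {n k : ℕ} {S : Set} (S↔Fin : S ↔ Fin k) (next : S → Fin n → S) where
  open Inverse S↔Fin

  encodedNext : Fin k → Fin n → Fin k
  encodedNext i a = to (next (from i) a)

  encodedAlg : S → (S → Fin n) → StreamAlg n
  encodedAlg start answer = record { states = k ; init = to start ; step = encodedNext ; output = answer ∘ from }

  from-foldl : ∀ {m} s (v : Vec (Fin n) m) → from (foldl _ encodedNext (to s) v) ≡ foldl _ next s v
  from-foldl s []      = strictlyInverseʳ s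
  from-foldl s (x ∷ v) = trans (cong (λ s′ → from (foldl _ encodedNext (to (next s′ x)) v)) (strictlyInverseʳ s))
                               (from-foldl (next s x) v)

  encodedAlg-solves : ∀ {r} start answer →
    (∀ (v : Vec (Fin n) r) i → answer (foldl _ next start v) ≢ lookup v i) →
    SolvesMIF r (encodedAlg start answer)
  encodedAlg-solves start answer avoids v i =
    subst (λ s → answer s ≢ lookup v i) (sym (from-foldl start v)) (avoids v i)

module Invariants {S : Set} {n : ℕ} (next : S → Fin n → S)
  (Inv : ℕ → S → Set) (Covers : S → Fin n → Set)
  (next-inv    : ∀ {m s} x → Inv (suc m) s → Inv m (next s x))
  (next-covers : ∀ {m s} x → Inv (suc m) s → Covers (next s x) x)
  (next-keeps  : ∀ {m s a} x → Inv (suc m) s → Covers s a → Covers (next s x) a)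
  where

  foldl-inv : ∀ {m s} (v : Vec (Fin n) m) → Inv m s → Inv 0 (foldl _ next s v)
  foldl-inv []      I = I
  foldl-inv (x ∷ v) I = foldl-inv v (next-inv x I)

  foldl-keeps : ∀ {m s a} (v : Vec (Fin n) m) → Inv m s → Covers s a → Covers (foldl _ next s v) a
  foldl-keeps []      I c = c
  foldl-keeps (x ∷ v) I c = foldl-keeps v (next-inv x I) (next-keeps x I c)

  foldl-covers : ∀ {m s} (v : Vec (Fin n) m) → Inv m s → ∀ i → Covers (foldl _ next s v) (lookup v i)
  foldl-covers (x ∷ v) I zero    = foldl-keeps v (next-inv x I) (next-covers x I)
  foldl-covers (x ∷ v) I (suc i) = foldl-covers v (next-inv x I) i

Subset↔Fin : ∀ m → Subset m ↔ Fin (2 ^ m)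
Subset↔Fin m = ↔-sym (↔-trans (Fin[m^n]↔Fin[m]^n 2 m) (↔-trans (lift↔ m 2↔Bool) (↔Vec m)))

∣p∪q∣≤∣p∣+∣q∣ : ∀ {n} (p q : Subset n) → ∣ p ∪ q ∣ ≤ ∣ p ∣ + ∣ q ∣
∣p∪q∣≤∣p∣+∣q∣ []          []          = z≤n
∣p∪q∣≤∣p∣+∣q∣ (true ∷ p)  (b ∷ q)     = s≤s (≤-trans (∣p∪q∣≤∣p∣+∣q∣ p q) (+-monoʳ-≤ ∣ p ∣ (∣p∣≤∣x∷p∣ b q)))
∣p∪q∣≤∣p∣+∣q∣ (false ∷ p) (true ∷ q)  = subst (suc ∣ p ∪ q ∣ ≤_) (sym (+-suc ∣ p ∣ ∣ q ∣)) (s≤s (∣p∪q∣≤∣p∣+∣q∣ p q))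
∣p∪q∣≤∣p∣+∣q∣ (false ∷ p) (false ∷ q) = ∣p∪q∣≤∣p∣+∣q∣ p q

∣⁅x⁆∪p∣≤1+∣p∣ : ∀ {n} (x : Fin n) p → ∣ ⁅ x ⁆ ∪ p ∣ ≤ suc ∣ p ∣
∣⁅x⁆∪p∣≤1+∣p∣ x p = subst (λ c → ∣ ⁅ x ⁆ ∪ p ∣ ≤ c + ∣ p ∣) (∣⁅x⁆∣≡1 x) (∣p∪q∣≤∣p∣+∣q∣ ⁅ x ⁆ p)

choose∉ : ∀ {m} → Subset (suc m) → Fin (suc m)
choose∉ p with nonempty? (∁ p)
... | yes (x , _) = x
... | no  _       = zero

choose∉-∉ : ∀ {m} (p : Subset (suc m)) → ∣ p ∣ < suc m → choose∉ p ∉ p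
choose∉-∉ {m} p ∣p∣<1+m with nonempty? (∁ p)
... | yes (x , x∈∁p) = x∈∁p⇒x∉p x∈∁p
... | no  ∁p-empty   = contradiction full (<⇒≱ ∣p∣<1+m)
  where
  full : suc m ≤ ∣ p ∣
  full = subst (_≤ ∣ p ∣) (∣⊤∣≡n (suc m)) (p⊆q⇒∣p∣≤∣q∣ ⊤⊆p)
    where
    ⊤⊆p : ⊤ ⊆ p
    ⊤⊆p {x} _ = x∉∁p⇒x∈p (λ x∈∁p → ∁p-empty (x , x∈∁p))

fromℕ-or : ∀ {m} → Fin m → ℕ → Fin m
fromℕ-or {m} d x with x <? m
... | yes x<m = fromℕ< x<m
... | no  _   = d

toℕ-fromℕ-or : ∀ {m} (d : Fin m) {x} → x < m → toℕ (fromℕ-or d x) ≡ x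
toℕ-fromℕ-or {m} d {x} x<m with x <? m
... | yes x<m′ = toℕ-fromℕ< x<m′
... | no  x≮m  = contradiction x<m x≮m

divMod-unique : ∀ {m} .{{_ : NonZero m}} {q} p (i : Fin m) → q ≡ p * m + toℕ i → q / m ≡ p × q mod m ≡ i
divMod-unique {m} p i refl = quotient , toℕ-injective remainder
  where
  quotient : (p * m + toℕ i) / m ≡ p
  quotient = begin
    (p * m + toℕ i) / m     ≡⟨ +-distrib-/-∣ˡ (toℕ i) (divides-refl p) ⟩
    p * m / m + toℕ i / m   ≡⟨ cong₂ _+_ (m*n/n≡m p m) (m<n⇒m/n≡0 (toℕ<n i)) ⟩
    p + 0                   ≡⟨ +-identityʳ p ⟩
    p                       ∎
    where open ≡-Reasoning
  remainder : toℕ ((p * m + toℕ i) mod m) ≡ toℕ i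
  remainder = begin
    toℕ ((p * m + toℕ i) mod m) ≡⟨ toℕ-fromℕ< _ ⟩
    (p * m + toℕ i) % m         ≡⟨ cong (_% m) (+-comm (p * m) (toℕ i)) ⟩
    (toℕ i + p * m) % m         ≡⟨ [m+kn]%n≡m%n (toℕ i) p m ⟩
    toℕ i % m                   ≡⟨ m<n⇒m%n≡m (toℕ<n i) ⟩
    toℕ i                       ∎
    where open ≡-Reasoning

m<[1+m/n]*n : ∀ m n .{{_ : NonZero n}} → m < suc (m / n) * n
m<[1+m/n]*n m n = begin-strict
  m                  ≡⟨ m≡m%n+[m/n]*n m n ⟩
  m % n + m / n * n  <⟨ +-monoˡ-< (m / n * n) (m%n<n m n) ⟩
  suc (m / n) * n    ∎
  where open ≤-Reasoning

2^k+2≤2^[k+2] : ∀ k → 2 ^ k + 2 ≤ 2 ^ (k + 2)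
2^k+2≤2^[k+2] k = begin
  2 ^ k + 2          ≤⟨ +-monoʳ-≤ (2 ^ k) (*-monoʳ-≤ 2 (m^n>0 2 k)) ⟩
  2 ^ k + 2 * 2 ^ k  ≤⟨ +-monoʳ-≤ (2 ^ k) (*-monoˡ-≤ (2 ^ k) (n≤1+n 2)) ⟩
  2 ^ k + 3 * 2 ^ k  ≡⟨ *-comm 4 (2 ^ k) ⟩
  2 ^ k * 2 ^ 2      ≡⟨ ^-distribˡ-+-* 2 k 2 ⟨
  2 ^ (k + 2)        ∎
  where open ≤-Reasoning

nested-block-≤ : ∀ {m} p (i : Fin m) w → suc (p * m + toℕ i) * w ≤ suc p * (m * w)
nested-block-≤ {m} p i w = begin
  suc (p * m + toℕ i) * w ≡⟨ cong (_* w) (sym (+-suc (p * m) (toℕ i))) ⟩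
  (p * m + suc (toℕ i)) * w ≤⟨ *-monoˡ-≤ w (+-monoʳ-≤ (p * m) (toℕ<n i)) ⟩
  (p * m + m) * w          ≡⟨ cong (_* w) (+-comm (p * m) m) ⟩
  suc p * m * w            ≡⟨ *-assoc (suc p) m w ⟩
  suc p * (m * w)          ∎
  where open ≤-Reasoning

2*m≡m+m : ∀ m → 2 * m ≡ m + m
2*m≡m+m m = cong (m +_) (+-identityʳ m)

n<2^n : ∀ n → n < 2 ^ n
n<2^n zero    = s≤s z≤n
n<2^n (suc n) = +-mono-≤ (m^n>0 2 n) (≤-trans (n<2^n n) (m≤m+n (2 ^ n) 0))

m≤2^k⇒⌈log₂m⌉≤k : ∀ {m} k → m ≤ 2 ^ k → ⌈log₂ m ⌉ ≤ k
m≤2^k⇒⌈log₂m⌉≤k k m≤2^k = subst (_ ≤_) (⌈log₂2^n⌉≡n k) (⌈log₂⌉-mono-≤ m≤2^k)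

n≤⌈n/2⌉+⌈n/2⌉ : ∀ n → n ≤ ⌈ n /2⌉ + ⌈ n /2⌉
n≤⌈n/2⌉+⌈n/2⌉ n = subst (_≤ ⌈ n /2⌉ + ⌈ n /2⌉) (⌊n/2⌋+⌈n/2⌉≡n n) (+-monoˡ-≤ ⌈ n /2⌉ (⌊n/2⌋≤⌈n/2⌉ n))

⌊n/2⌋+⌊n/2⌋≤n : ∀ n → ⌊ n /2⌋ + ⌊ n /2⌋ ≤ n
⌊n/2⌋+⌊n/2⌋≤n n = subst (⌊ n /2⌋ + ⌊ n /2⌋ ≤_) (⌊n/2⌋+⌈n/2⌉≡n n) (+-monoʳ-≤ ⌊ n /2⌋ (⌊n/2⌋≤⌈n/2⌉ n))

n≤2^⌈log2⌉n : ∀ n (rec : Acc _<_ n) → n ≤ 2 ^ ⌈log2⌉ n rec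
n≤2^⌈log2⌉n 0             _        = z≤n
n≤2^⌈log2⌉n 1             _        = s≤s z≤n
n≤2^⌈log2⌉n (suc (suc n)) (acc rs) = begin
  suc (suc n)                      ≤⟨ s≤s (s≤s (n≤⌈n/2⌉+⌈n/2⌉ n)) ⟩
  suc (suc (⌈ n /2⌉ + ⌈ n /2⌉))    ≡⟨ cong suc (sym (+-suc ⌈ n /2⌉ ⌈ n /2⌉)) ⟩
  suc ⌈ n /2⌉ + suc ⌈ n /2⌉        ≡⟨ sym (2*m≡m+m (suc ⌈ n /2⌉)) ⟩
  2 * suc ⌈ n /2⌉                 ≤⟨ *-monoʳ-≤ 2 (n≤2^⌈log2⌉n (suc ⌈ n /2⌉) _) ⟩
  2 * 2 ^ ⌈log2⌉ (suc ⌈ n /2⌉) _   ∎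
  where open ≤-Reasoning

2^⌊log2⌋n≤n : ∀ n .{{_ : NonZero n}} (rec : Acc _<_ n) → 2 ^ ⌊log2⌋ n rec ≤ n
2^⌊log2⌋n≤n 1             _        = ≤-refl
2^⌊log2⌋n≤n (suc (suc n)) (acc rs) = begin
  2 * 2 ^ ⌊log2⌋ (suc ⌊ n /2⌋) _   ≤⟨ *-monoʳ-≤ 2 (2^⌊log2⌋n≤n (suc ⌊ n /2⌋) _) ⟩
  2 * suc ⌊ n /2⌋                 ≡⟨ 2*m≡m+m (suc ⌊ n /2⌋) ⟩
  suc ⌊ n /2⌋ + suc ⌊ n /2⌋        ≡⟨ cong suc (+-suc ⌊ n /2⌋ ⌊ n /2⌋) ⟩
  suc (suc (⌊ n /2⌋ + ⌊ n /2⌋))    ≤⟨ s≤s (s≤s (⌊n/2⌋+⌊n/2⌋≤n n)) ⟩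
  suc (suc n)                      ∎
  where open ≤-Reasoning

n≤2^⌈log₂n⌉ : ∀ n → n ≤ 2 ^ ⌈log₂ n ⌉
n≤2^⌈log₂n⌉ n = n≤2^⌈log2⌉n n (<-wellFounded n)

2^⌊log₂n⌋≤n : ∀ n .{{_ : NonZero n}} → 2 ^ ⌊log₂ n ⌋ ≤ n
2^⌊log₂n⌋≤n n = 2^⌊log2⌋n≤n n (<-wellFounded n)

n<[1+⌊√n⌋]² : ∀ n → n < suc ⌊√ n ⌋ * suc ⌊√ n ⌋
n<[1+⌊√n⌋]² zero = s≤s z≤n
n<[1+⌊√n⌋]² (suc n) with suc ⌊√ n ⌋ * suc ⌊√ n ⌋ ≤? suc n
... | yes _   = ≤-trans (s≤s (n<[1+⌊√n⌋]² n)) (*-mono-< (n<1+n (suc ⌊√ n ⌋)) (n<1+n (suc ⌊√ n ⌋)))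
... | no  n≱  = ≰⇒> n≱

m*m≤n⇒m≤⌊√n⌋ : ∀ {m n} → m * m ≤ n → m ≤ ⌊√ n ⌋
m*m≤n⇒m≤⌊√n⌋ {m} {n} m*m≤n with m ≤? ⌊√ n ⌋
... | yes m≤√n = m≤√n
... | no  m≰√n = contradiction (≤-<-trans m*m≤n (n<[1+⌊√n⌋]² n)) (≤⇒≯ (*-mono-≤ m>√n m>√n))
  where m>√n = ≰⇒> m≰√n

*-≤-2^ : ∀ {a b} x y → a ≤ 2 ^ x → b ≤ 2 ^ y → a * b ≤ 2 ^ (x + y)
*-≤-2^ x y a≤ b≤ = ≤-trans (*-mono-≤ a≤ b≤) (≤-reflexive (sym (^-distribˡ-+-* 2 x y)))

^-≤-2^ : ∀ {a} x k → a ≤ 2 ^ x → a ^ k ≤ 2 ^ (x * k)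
^-≤-2^ x k a≤ = ≤-trans (^-monoˡ-≤ k a≤) (≤-reflexive (^-*-assoc 2 x k))

-- With M = ℓ + 1 and P = M ^ t, a number below P is a string of t digits
-- in base M. At level k with prefix p the current block is the set of a
-- with a / M ^ (k + 1) = p; it splits into M sub-blocks according to the
-- digit (a / M ^ k) mod M.
module Descent {n : ℕ} (ℓ u : ℕ) (P≤n : suc ℓ ^ suc u ≤ n) where

  M t P : ℕ
  M = suc ℓ
  t = suc u
  P = M ^ t

  block : ℕ → Fin n → ℕ
  block k a = _/_ (toℕ a) (M ^ k) {{m^n≢0 M k}}

  block-suc : ∀ k a → block k a / M ≡ block (suc k) a
  block-suc k a = begin
    toℕ a / M ^ k / M     ≡⟨ m/n/o≡m/[n*o] (toℕ a) (M ^ k) M ⟩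
    toℕ a / (M ^ k * M)   ≡⟨ /-congʳ (*-comm (M ^ k) M) ⟩
    toℕ a / M ^ suc k     ∎
    where
    open ≡-Reasoning
    instance
      M^k≢0 : NonZero (M ^ k)
      M^k≢0 = m^n≢0 M k
      M^k*M≢0 : NonZero (M ^ k * M)
      M^k*M≢0 = m*n≢0 (M ^ k) M
      M^[1+k]≢0 : NonZero (M ^ suc k)
      M^[1+k]≢0 = m^n≢0 M (suc k)

  record State : Set where
    constructor ⟨_,_,_,_⟩
    field
      level  : Fin t
      count  : Fin M
      prefix : Fin P
      marked : Subset M
  open State

  State↔Fin : State ↔ Fin (t * (M * (P * 2 ^ M)))
  State↔Fin = ↔-trans (mk↔ₛ′ fields ⟨_⟩′ (λ _ → refl) (λ _ → refl))
    (↔-sym (↔-trans *↔× (↔-refl ×-↔ (↔-trans *↔× (↔-refl ×-↔ (↔-trans *↔× (↔-refl ×-↔ ↔-sym (Subset↔Fin M))))))))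
    where
    fields : State → Fin t × Fin M × Fin P × Subset M
    fields s = level s , count s , prefix s , marked s
    ⟨_⟩′ : Fin t × Fin M × Fin P × Subset M → State
    ⟨ k , c , p , B ⟩′ = ⟨ k , c , p , B ⟩

  target : State → ℕ
  target s = toℕ (prefix s) * M + toℕ (choose∉ (marked s))

  descend : State → State
  descend s = ⟨ fromℕ-or (level s) (pred (toℕ (level s))) , zero , fromℕ-or (prefix s) (target s) , ∅ ⟩

  -- Descent happens lazily, when an element arrives at a full level, so the
  -- last level is never left and level 0 needs no predecessor.
  prepare : State → State
  prepare s with toℕ (count s) ≟ ℓ
  ... | yes _ = descend s
  ... | no  _ = s

  mark : State → Fin n → Subset M
  mark s x with block (toℕ (level s)) x / M ≟ toℕ (prefix s)
  ... | yes _ = ⁅ block (toℕ (level s)) x mod M ⁆ ∪ marked s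
  ... | no  _ = marked s

  consume : State → Fin n → State
  consume s x = ⟨ level s , fromℕ-or (count s) (suc (toℕ (count s))) , prefix s , mark s x ⟩

  next : State → Fin n → State
  next s x = consume (prepare s) x

  start : State
  start = ⟨ fromℕ u , zero , fromℕ< (m^n>0 M t) , ∅ ⟩

  answer : State → Fin n
  answer s = fromℕ-or (fromℕ< (≤-trans (m^n>0 M t) P≤n)) (target s * M ^ toℕ (level s))

  -- m is the number of stream elements still to be read.
  record Invariant (m : ℕ) (s : State) : Set where
    field
      budget    : toℕ (count s) + m ≤ suc (toℕ (level s)) * ℓ
      few-marks : ∣ marked s ∣ ≤ toℕ (count s)
      in-range  : suc (toℕ (prefix s)) * M ^ suc (toℕ (level s)) ≤ P
  open Invariant

  Covers : State → Fin n → Set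
  Covers s a = block (toℕ (level s)) a / M ≡ toℕ (prefix s) → block (toℕ (level s)) a mod M ∈ marked s

  choose∉-free : ∀ {m s} → Invariant m s → choose∉ (marked s) ∉ marked s
  choose∉-free {s = s} I = choose∉-∉ (marked s) (≤-<-trans (few-marks I) (toℕ<n (count s)))

  covered-≢target : ∀ {m s a} → Invariant m s → Covers s a → block (toℕ (level s)) a ≢ target s
  covered-≢target {s = s} I covered eq =
    choose∉-free I (subst (_∈ marked s) (proj₂ digits) (covered (proj₁ digits)))
    where digits = divMod-unique (toℕ (prefix s)) (choose∉ (marked s)) eq

  target-in-range : ∀ {m s} → Invariant m s → suc (target s) * M ^ toℕ (level s) ≤ P
  target-in-range {s = s} I =
    ≤-trans (nested-block-≤ (toℕ (prefix s)) (choose∉ (marked s)) (M ^ toℕ (level s))) (in-range I)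

  block-answer : ∀ {m s} → Invariant m s → block (toℕ (level s)) (answer s) ≡ target s
  block-answer {s = s} I = begin
    _/_ (toℕ (answer s)) (M ^ k) {{M^k≢0}} ≡⟨ cong (λ x → _/_ x (M ^ k) {{M^k≢0}}) (toℕ-fromℕ-or _ below-n) ⟩
    _/_ (target s * M ^ k) (M ^ k) {{M^k≢0}} ≡⟨ m*n/n≡m (target s) (M ^ k) {{M^k≢0}} ⟩
    target s ∎
    where
    open ≡-Reasoning
    k = toℕ (level s)
    M^k≢0 = m^n≢0 M k
    below-n : target s * M ^ k < n
    below-n = ≤-trans (m<n+m (target s * M ^ k) (m^n>0 M k)) (≤-trans (target-in-range I) P≤n)

  answer-uncovered : ∀ {m s a} → Invariant m s → Covers s a → answer s ≢ a
  answer-uncovered I covered refl = covered-≢target I covered (block-answer I)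

  full-level-budget : ∀ {m s} → Invariant (suc m) s → toℕ (count s) ≡ ℓ → suc m ≤ toℕ (level s) * ℓ
  full-level-budget {m} {s} I c≡ℓ =
    +-cancelˡ-≤ ℓ _ _ (subst (λ c → c + suc m ≤ suc (toℕ (level s)) * ℓ) c≡ℓ (budget I))

  full-level-nonZero : ∀ {m s} → Invariant (suc m) s → toℕ (count s) ≡ ℓ → NonZero (toℕ (level s) * ℓ)
  full-level-nonZero I c≡ℓ = >-nonZero (≤-trans (s≤s z≤n) (full-level-budget I c≡ℓ))

  level-descend : ∀ {m s} → Invariant (suc m) s → toℕ (count s) ≡ ℓ → suc (toℕ (level (descend s))) ≡ toℕ (level s)
  level-descend {s = s} I c≡ℓ = begin
    suc (toℕ (fromℕ-or (level s) (pred k))) ≡⟨ cong suc (toℕ-fromℕ-or (level s) (≤-<-trans pred[n]≤n (toℕ<n (level s)))) ⟩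
    suc (pred k)                            ≡⟨ suc-pred k {{m*n≢0⇒m≢0 k {{full-level-nonZero I c≡ℓ}}}} ⟩
    k                                       ∎
    where
    open ≡-Reasoning
    k = toℕ (level s)

  prefix-descend : ∀ {m s} → Invariant m s → toℕ (prefix (descend s)) ≡ target s
  prefix-descend {s = s} I = toℕ-fromℕ-or (prefix s)
    (≤-trans (m≤m*n (suc (target s)) (M ^ toℕ (level s)) {{m^n≢0 M (toℕ (level s))}}) (target-in-range I))

  descend-inv : ∀ {m s} → Invariant (suc m) s → toℕ (count s) ≡ ℓ → Invariant (suc m) (descend s)
  descend-inv {m} I c≡ℓ = record
    { budget    = subst (λ k → suc m ≤ k * ℓ) (sym (level-descend I c≡ℓ)) (full-level-budget I c≡ℓ)
    ; few-marks = ≤-reflexive (∣⊥∣≡0 M)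
    ; in-range  = subst₂ (λ p k → suc p * M ^ k ≤ P) (sym (prefix-descend I)) (sym (level-descend I c≡ℓ))
                         (target-in-range I)
    }

  descend-keeps : ∀ {m s a} → Invariant (suc m) s → toℕ (count s) ≡ ℓ → Covers s a → Covers (descend s) a
  descend-keeps {s = s} {a} I c≡ℓ covered in-block = ⊥-elim (covered-≢target I covered at-target)
    where
    open ≡-Reasoning
    k′ = toℕ (level (descend s))
    at-target : block (toℕ (level s)) a ≡ target s
    at-target = begin
      block (toℕ (level s)) a   ≡⟨ cong (λ k → block k a) (sym (level-descend I c≡ℓ)) ⟩
      block (suc k′) a          ≡⟨ sym (block-suc k′ a) ⟩
      block k′ a / M            ≡⟨ in-block ⟩
      toℕ (prefix (descend s))  ≡⟨ prefix-descend I ⟩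
      target s                  ∎

  prepare-inv : ∀ {m s} → Invariant (suc m) s → Invariant (suc m) (prepare s) × toℕ (count (prepare s)) < ℓ
  prepare-inv {m} {s} I with toℕ (count s) ≟ ℓ
  ... | yes c≡ℓ = descend-inv I c≡ℓ ,
                  >-nonZero⁻¹ ℓ {{m*n≢0⇒n≢0 (toℕ (level s)) {{full-level-nonZero I c≡ℓ}}}}
  ... | no  c≢ℓ = I , ≤∧≢⇒< (s≤s⁻¹ (toℕ<n (count s))) c≢ℓ

  prepare-keeps : ∀ {m s a} → Invariant (suc m) s → Covers s a → Covers (prepare s) a
  prepare-keeps {s = s} I covered with toℕ (count s) ≟ ℓ
  ... | yes c≡ℓ = descend-keeps I c≡ℓ covered
  ... | no  _   = covered

  marked⊆mark : ∀ s x → marked s ⊆ mark s x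
  marked⊆mark s x d∈B with block (toℕ (level s)) x / M ≟ toℕ (prefix s)
  ... | yes _ = x∈p∪q⁺ (inj₂ d∈B)
  ... | no  _ = d∈B

  ∣mark∣≤1+∣marked∣ : ∀ s x → ∣ mark s x ∣ ≤ suc ∣ marked s ∣
  ∣mark∣≤1+∣marked∣ s x with block (toℕ (level s)) x / M ≟ toℕ (prefix s)
  ... | yes _ = ∣⁅x⁆∪p∣≤1+∣p∣ (block (toℕ (level s)) x mod M) (marked s)
  ... | no  _ = n≤1+n _

  consume-covers : ∀ s x → Covers (consume s x) x
  consume-covers s x in-block with block (toℕ (level s)) x / M ≟ toℕ (prefix s)
  ... | yes _     = x∈p∪q⁺ (inj₁ (x∈⁅x⁆ _))
  ... | no  q≢p   = contradiction in-block q≢p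

  consume-inv : ∀ {m s} x → Invariant (suc m) s → toℕ (count s) < ℓ → Invariant m (consume s x)
  consume-inv {m} {s} x I c<ℓ = record
    { budget    = subst (λ c → c + m ≤ suc (toℕ (level s)) * ℓ) (sym count≡)
                        (subst (_≤ suc (toℕ (level s)) * ℓ) (+-suc (toℕ (count s)) m) (budget I))
    ; few-marks = subst (∣ mark s x ∣ ≤_) (sym count≡) (≤-trans (∣mark∣≤1+∣marked∣ s x) (s≤s (few-marks I)))
    ; in-range  = in-range I
    }
    where
    count≡ : toℕ (fromℕ-or (count s) (suc (toℕ (count s)))) ≡ suc (toℕ (count s))
    count≡ = toℕ-fromℕ-or (count s) (s≤s c<ℓ)

  next-inv : ∀ {m s} x → Invariant (suc m) s → Invariant m (next s x)
  next-inv x I = consume-inv x (proj₁ (prepare-inv I)) (proj₂ (prepare-inv I))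

  next-keeps : ∀ {m s a} x → Invariant (suc m) s → Covers s a → Covers (next s x) a
  next-keeps {s = s} x I covered in-block = marked⊆mark (prepare s) x (prepare-keeps I covered in-block)

  start-inv : ∀ {r} → r ≤ t * ℓ → Invariant r start
  start-inv r≤tℓ = record
    { budget    = subst (λ k → _ ≤ suc k * ℓ) (sym (toℕ-fromℕ u)) r≤tℓ
    ; few-marks = ≤-reflexive (∣⊥∣≡0 M)
    ; in-range  = subst₂ (λ p k → suc p * M ^ suc k ≤ P) (sym (toℕ-fromℕ< (m^n>0 M t))) (sym (toℕ-fromℕ u))
                         (≤-reflexive (*-identityˡ P))
    }

  open Encoded State↔Fin next
  open Invariants next Invariant Covers next-inv (λ {_} {s} x _ → consume-covers (prepare s) x) next-keeps

  algorithm : StreamAlg n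
  algorithm = encodedAlg start answer

  algorithm-solves : ∀ {r} → r ≤ t * ℓ → SolvesMIF r algorithm
  algorithm-solves r≤tℓ = encodedAlg-solves start answer
    (λ v i → answer-uncovered (foldl-inv v (start-inv r≤tℓ)) (foldl-covers v (start-inv r≤tℓ) i))

  algorithm-space : ∀ {x e} → t ≤ 2 ^ x → M ≤ 2 ^ e → space algorithm ≤ x + (e + (e * t + M))
  algorithm-space {x} {e} t≤2^x M≤2^e = m≤2^k⇒⌈log₂m⌉≤k (x + (e + (e * t + M)))
    (*-≤-2^ x _ t≤2^x (*-≤-2^ e _ M≤2^e (*-≤-2^ (e * t) M (^-≤-2^ e t M≤2^e) ≤-refl)))

module Parameters (n r : ℕ) (1≤r : 1 ≤ r) (r<n : r < n) where

  L k R s : ℕ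
  L = ⌊log₂ n ⌋
  k = ⌈log₂ r ⌉
  R = r * k
  s = ⌊√ R ⌋

  Within : ℕ → Set
  Within E = Σ (StreamAlg n) λ A → SolvesMIF r A × space A ≤ E

  bound : ℕ
  bound = 16 * (s * L + R) + 16 * L

  Bounded : Set
  Bounded = Σ (StreamAlg n) λ A → SolvesMIF r A × space A * L ≤ bound

  within⇒bounded : ∀ {E} → Within E → E * L ≤ bound → Bounded
  within⇒bounded (A , solves , space≤E) E*L≤ = A , solves , ≤-trans (*-monoˡ-≤ L space≤E) E*L≤

  ≤-bound : ∀ a b c → a ≤ 16 → b ≤ 16 → c ≤ 16 → a * (s * L) + b * R + c * L ≤ bound
  ≤-bound a b c a≤ b≤ c≤ = begin
    a * (s * L) + b * R + c * L       ≤⟨ +-mono-≤ (+-mono-≤ (*-monoˡ-≤ (s * L) a≤) (*-monoˡ-≤ R b≤)) (*-monoˡ-≤ L c≤) ⟩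
    16 * (s * L) + 16 * R + 16 * L    ≡⟨ cong (_+ 16 * L) (sym (*-distribˡ-+ 16 (s * L) R)) ⟩
    16 * (s * L + R) + 16 * L         ∎
    where open ≤-Reasoning

  k≤s : k ≤ s
  k≤s = m*m≤n⇒m≤⌊√n⌋ (*-monoˡ-≤ k (m≤2^k⇒⌈log₂m⌉≤k r (<⇒≤ (n<2^n r))))

  single-level : Within (4 * r)
  single-level = algorithm , algorithm-solves (≤-reflexive (sym (*-identityˡ r))) ,
                 ≤-trans (algorithm-space {x = 0} {e = r} (s≤s z≤n) (n<2^n r)) 3r+1≤4r
    where
    open Descent r 0 (subst (_≤ n) (sym (*-identityʳ (suc r))) r<n) using (algorithm; algorithm-solves; algorithm-space)
    3r+1≤4r : 0 + (r + (r * 1 + suc r)) ≤ 4 * r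
    3r+1≤4r = subst₂ _≤_ (3r+1≡space r) (3r+r≡4r r) (+-monoʳ-≤ (3 * r) 1≤r)
      where
      3r+1≡space : ∀ r → 3 * r + 1 ≡ 0 + (r + (r * 1 + suc r))
      3r+1≡space = solve-∀
      3r+r≡4r : ∀ r → 3 * r + r ≡ 4 * r
      3r+r≡4r = solve-∀

  multi-level : ∀ t .{{_ : NonZero t}} → 1 ≤ k → 3 * k * t ≤ L → Within (k * t + 3 * t + k + r / t + 4)
  multi-level t@(suc u) 1≤k 3kt≤L =
    algorithm , algorithm-solves r≤t[q+1] ,
    ≤-trans (algorithm-space {x = t} {e = k + 2} (<⇒≤ (n<2^n t)) q+2≤2^[k+2]) (≤-reflexive (space≡ k t q))
    where
    q = r / t
    q+2≤2^[k+2] : suc (q + 1) ≤ 2 ^ (k + 2)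
    q+2≤2^[k+2] = begin
      suc (q + 1) ≡⟨ +-suc q 1 ⟨
      q + 2       ≤⟨ +-monoˡ-≤ 2 (≤-trans (m/n≤m r t) (n≤2^⌈log₂n⌉ r)) ⟩
      2 ^ k + 2   ≤⟨ 2^k+2≤2^[k+2] k ⟩
      2 ^ (k + 2) ∎
      where open ≤-Reasoning
    P≤n : suc (q + 1) ^ t ≤ n
    P≤n = begin
      suc (q + 1) ^ t   ≤⟨ ^-≤-2^ (k + 2) t q+2≤2^[k+2] ⟩
      2 ^ ((k + 2) * t) ≤⟨ ^-monoʳ-≤ 2 (≤-trans (*-monoˡ-≤ t k+2≤3k) 3kt≤L) ⟩
      2 ^ L             ≤⟨ 2^⌊log₂n⌋≤n n {{>-nonZero (≤-trans (s≤s z≤n) r<n)}} ⟩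
      n                 ∎
      where
      open ≤-Reasoning
      k+2≤3k : k + 2 ≤ 3 * k
      k+2≤3k = +-monoʳ-≤ k (+-mono-≤ 1≤k (≤-trans 1≤k (m≤m+n k 0)))
    r≤t[q+1] : r ≤ t * (q + 1)
    r≤t[q+1] = ≤-trans (<⇒≤ (m<[1+m/n]*n r t)) (≤-reflexive (trans (*-comm (suc q) t) (cong (t *_) (+-comm 1 q))))
    open Descent (q + 1) u P≤n using (algorithm; algorithm-solves; algorithm-space)
    space≡ : ∀ k t q → t + ((k + 2) + ((k + 2) * t + suc (q + 1))) ≡ k * t + 3 * t + k + q + 4
    space≡ = solve-∀

  single-level-bounded : k ≡ 0 ⊎ L ≤ 3 * k → Bounded
  single-level-bounded (inj₁ k≡0) = within⇒bounded single-level
    (≤-trans (*-monoˡ-≤ L (*-monoʳ-≤ 4 r≤1)) (≤-bound 0 0 4 z≤n z≤n (m≤m+n 4 12)))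
    where
    r≤1 : r ≤ 1
    r≤1 = subst (λ e → r ≤ 2 ^ e) k≡0 (n≤2^⌈log₂n⌉ r)
  single-level-bounded (inj₂ L≤3k) = within⇒bounded single-level (begin
    4 * r * L                    ≤⟨ *-monoʳ-≤ (4 * r) L≤3k ⟩
    4 * r * (3 * k)              ≡⟨ regroup r k (s * L) L ⟩
    0 * (s * L) + 12 * R + 0 * L ≤⟨ ≤-bound 0 12 0 z≤n (m≤m+n 12 4) z≤n ⟩
    16 * (s * L + R) + 16 * L    ∎)
    where
    open ≤-Reasoning
    regroup : ∀ r k x y → 4 * r * (3 * k) ≡ 0 * x + 12 * (r * k) + 0 * y
    regroup = solve-∀

  multi-level-bounded : ∀ t .{{_ : NonZero t}} → 1 ≤ k → 3 * k * t ≤ L → k * t ≤ s →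
                        r / t * L ≤ 8 * (s * L + R) → Bounded
  multi-level-bounded t 1≤k 3kt≤L kt≤s [r/t]*L≤ = within⇒bounded (multi-level t 1≤k 3kt≤L) (begin
    (k * t + 3 * t + k + r / t + 4) * L     ≤⟨ *-monoˡ-≤ L (+-monoˡ-≤ 4 (+-monoˡ-≤ (r / t) levels≤)) ⟩
    (s + 3 * s + s + r / t + 4) * L         ≡⟨ expand s (r / t) L ⟩
    5 * (s * L) + r / t * L + 4 * L         ≤⟨ +-monoˡ-≤ (4 * L) (+-monoʳ-≤ (5 * (s * L)) [r/t]*L≤) ⟩
    5 * (s * L) + 8 * (s * L + R) + 4 * L   ≡⟨ regroup (s * L) R L ⟩
    13 * (s * L) + 8 * R + 4 * L            ≤⟨ ≤-bound 13 8 4 (m≤m+n 13 3) (m≤m+n 8 8) (m≤m+n 4 12) ⟩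
    16 * (s * L + R) + 16 * L               ∎)
    where
    open ≤-Reasoning
    levels≤ : k * t + 3 * t + k ≤ s + 3 * s + s
    levels≤ = +-mono-≤ (+-mono-≤ kt≤s (*-monoʳ-≤ 3 (≤-trans (m≤n*m t k {{>-nonZero 1≤k}}) kt≤s))) k≤s
    expand : ∀ s q L → (s + 3 * s + s + q + 4) * L ≡ 5 * (s * L) + q * L + 4 * L
    expand = solve-∀
    regroup : ∀ x R L → 5 * x + 8 * (x + R) + 4 * L ≡ 13 * x + 8 * R + 4 * L
    regroup = solve-∀

  sqrt-levels : 1 ≤ k → 3 * s ≤ L → Bounded
  sqrt-levels 1≤k 3s≤L = multi-level-bounded t 1≤k 3kt≤L kt≤s [r/t]*L≤
    where
    instance
      k≢0 : NonZero k
      k≢0 = >-nonZero 1≤k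
    t = s / k
    instance
      t≢0 : NonZero t
      t≢0 = >-nonZero (m≥n⇒m/n>0 k≤s)
    kt≤s : k * t ≤ s
    kt≤s = subst (_≤ s) (*-comm t k) (m/n*n≤m s k)
    3kt≤L : 3 * k * t ≤ L
    3kt≤L = ≤-trans (≤-reflexive (*-assoc 3 k t)) (≤-trans (*-monoʳ-≤ 3 kt≤s) 3s≤L)
    1+s≤2s : suc s ≤ 2 * s
    1+s≤2s = ≤-trans (+-monoˡ-≤ s (≤-trans 1≤k k≤s)) (≤-reflexive (sym (2*m≡m+m s)))
    1+s≤2tk : suc s ≤ 2 * (t * k)
    1+s≤2tk = ≤-trans (m<[1+m/n]*n s k)
      (≤-trans (+-monoˡ-≤ (t * k) (m≤n*m k t)) (≤-reflexive (sym (2*m≡m+m (t * k)))))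
    -- R < (s + 1)² and s + 1 ≤ 2 s, 2 t k give R < 4 s t k, hence r < 4 s t after cancelling k.
    r<4st : r < 4 * s * t
    r<4st = *-cancelʳ-< k r (4 * s * t) (begin-strict
      r * k                   <⟨ n<[1+⌊√n⌋]² R ⟩
      suc s * suc s           ≤⟨ *-mono-≤ 1+s≤2s 1+s≤2tk ⟩
      2 * s * (2 * (t * k))   ≡⟨ regroup s t k ⟩
      4 * s * t * k           ∎)
      where
      open ≤-Reasoning
      regroup : ∀ s t k → 2 * s * (2 * (t * k)) ≡ 4 * s * t * k
      regroup = solve-∀
    [r/t]*L≤ : r / t * L ≤ 8 * (s * L + R)
    [r/t]*L≤ = begin
      r / t * L        ≤⟨ *-monoˡ-≤ L (<⇒≤ (m<n*o⇒m/o<n {n = 4 * s} r<4st)) ⟩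
      4 * s * L        ≡⟨ *-assoc 4 s L ⟩
      4 * (s * L)      ≤⟨ *-monoˡ-≤ (s * L) (m≤m+n 4 4) ⟩
      8 * (s * L)      ≤⟨ *-monoʳ-≤ 8 (m≤m+n (s * L) R) ⟩
      8 * (s * L + R)  ∎
      where open ≤-Reasoning

  log-levels : 1 ≤ k → 3 * k ≤ L → L < 3 * s → Bounded
  log-levels 1≤k 3k≤L L<3s = multi-level-bounded t 1≤k 3kt≤L kt≤s [r/t]*L≤
    where
    instance
      3k≢0 : NonZero (3 * k)
      3k≢0 = >-nonZero (≤-trans 1≤k (m≤n*m k 3))
    t = L / (3 * k)
    instance
      t≢0 : NonZero t
      t≢0 = >-nonZero (m≥n⇒m/n>0 3k≤L)
    3kt≤L : 3 * k * t ≤ L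
    3kt≤L = subst (_≤ L) (*-comm t (3 * k)) (m/n*n≤m L (3 * k))
    kt≤s : k * t ≤ s
    kt≤s = <⇒≤ (*-cancelˡ-< 3 (k * t) s (≤-<-trans (≤-reflexive (sym (*-assoc 3 k t))) (≤-<-trans 3kt≤L L<3s)))
    L≤6kt : L ≤ 3 * k * t + 3 * k * t
    L≤6kt = ≤-trans (<⇒≤ (m<[1+m/n]*n L (3 * k)))
      (≤-trans (+-monoˡ-≤ (t * (3 * k)) (m≤n*m (3 * k) t)) (≤-reflexive (cong₂ _+_ tk≡kt tk≡kt)))
      where
      tk≡kt : t * (3 * k) ≡ 3 * k * t
      tk≡kt = *-comm t (3 * k)
    [r/t]*L≤ : r / t * L ≤ 8 * (s * L + R)
    [r/t]*L≤ = begin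
      r / t * L                           ≤⟨ *-monoʳ-≤ (r / t) L≤6kt ⟩
      r / t * (3 * k * t + 3 * k * t)     ≡⟨ regroup (r / t) k t ⟩
      6 * (r / t * t * k)                 ≤⟨ *-monoʳ-≤ 6 (*-monoˡ-≤ k (m/n*n≤m r t)) ⟩
      6 * R                               ≤⟨ *-monoˡ-≤ R (m≤m+n 6 2) ⟩
      8 * R                               ≤⟨ *-monoʳ-≤ 8 (m≤n+m R (s * L)) ⟩
      8 * (s * L + R)                     ∎
      where
      open ≤-Reasoning
      regroup : ∀ q k t → q * (3 * k * t + 3 * k * t) ≡ 6 * (q * t * k)
      regroup = solve-∀

  bounded : Bounded
  bounded with k ≟ 0 | 3 * k ≤? L
  ... | yes k≡0 | _        = single-level-bounded (inj₁ k≡0)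
  ... | no  _   | no  3k≰L = single-level-bounded (inj₂ (<⇒≤ (≰⇒> 3k≰L)))
  ... | no  k≢0 | yes 3k≤L with 3 * s ≤? L
  ...   | yes 3s≤L = sqrt-levels (n≢0⇒n>0 k≢0) 3s≤L
  ...   | no  3s≰L = log-levels (n≢0⇒n>0 k≢0) 3k≤L (≰⇒> 3s≰L)

theorem8 : Σ ℕ λ C → (n r : ℕ) → 1 ≤ r → r < n →
    Σ (StreamAlg n) λ A → SolvesMIF r A ×
      (space A * ⌊log₂ n ⌋ ≤ C * (⌊√ (r * ⌈log₂ r ⌉) ⌋ * ⌊log₂ n ⌋ + r * ⌈log₂ r ⌉) + C * ⌊log₂ n ⌋)
theorem8 = 16 , λ n r 1≤r r<n → Parameters.bounded n r 1≤r r<n
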